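{- Let $k>0$, $X$ a set, $<_1,<_2$ strict orders on $X^k$, and $U$ a function assignment for $X^k$. Then $U$ is $<_1,<_2$-#-decreasing if and only if $U$ is $<_1,<_2$-$*$-decreasing. Moreover, if $U$ is $<_1,<_2$-#-decreasing, then $U$ is $<_1$-end-preserving.
   Context: A strict order is a transitive irreflexive binary relation. A function assignment for $X^k$ assigns to each finite $A\subseteq X^k$ a function $U(A):A\to A$. $U$ is $<_1,<_2$-#-decreasing if for all finite $A\subseteq X^k$ and $x\in X^k$, either $U(A)\subseteq U(A\cup\{x\})$ (as graphs) or there is $y\in A$ with $x<_1y$ and $U(A\cup\{x\})(y)<_2U(A)(y)$. For $f:A\to A$ and $g:B\to B$ ($A,B$ finite), write $f\,(<_1,<_2)^*\,g$ if for every $x\in A\cap B$: if for all $y\in A$ with $y<_1x$ we have $f(y)=g(y)$ (in particular $g(y)$ defined), then $f(x)=g(x)$ or $g(x)<_2f(x)$. $U$ is $<_1,<_2$-$*$-decreasing if $U(A)\,(<_1,<_2)^*\,U(B)$ for all finite $A,B\subseteq X^k$. For a strict order $<$, $A\subseteq_<B$ means $A\subseteq B$ and for all $x\in A$, $y\in B$ with $y<x$ we have $y\in A$; $U$ is $<$-end-preserving if $U(A)\subseteq U(B)$ for all finite $A\subseteq_<B\subseteq X^k$. -}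

module Defs where

open import Data.Nat using (ℕ)
open import Data.Vec using (Vec)
open import Data.List using (List; _∷_)
open import Data.List.Membership.Propositional using (_∈_)
open import Data.Product using (_×_; ∃-syntax)
open import Data.Sum using (_⊎_)
open import Relation.Binary.PropositionalEquality using (_≡_)
open import Relation.Binary.Core using (Rel)
open import Function.Bundles using (_⇔_)

Pt : Set → ℕ → Set
Pt X k = Vec X k

-- Finite subsets of X^k are represented by lists (duplicates/order irrelevant).
-- A function assignment: for each finite A, a function U(A) : A → A.
-- It is encoded as a total function on points whose values are only
-- relevant on A; it maps A into A and depends only on the set of elements
-- of A (not on the list representing it).
record FunAssign (X : Set) (k : ℕ) : Set where
  field
    U      : List (Pt X k) → Pt X k → Pt X k
    closed : ∀ A y → y ∈ A → U A y ∈ A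
    ext    : ∀ A B → (∀ z → (z ∈ A) ⇔ (z ∈ B)) → ∀ y → y ∈ A → U A y ≡ U B y

module _ {X : Set} {k : ℕ} where

  GraphSub : List (Pt X k) → (Pt X k → Pt X k) →
             List (Pt X k) → (Pt X k → Pt X k) → Set
  GraphSub A f B g = ∀ y → y ∈ A → (y ∈ B × g y ≡ f y)

  Star : Rel (Pt X k) _ → Rel (Pt X k) _ →
         List (Pt X k) → (Pt X k → Pt X k) →
         List (Pt X k) → (Pt X k → Pt X k) → Set
  Star _<₁_ _<₂_ A f B g =
    ∀ x → x ∈ A → x ∈ B →
      (∀ y → y ∈ A → y <₁ x → (y ∈ B × f y ≡ g y)) →
      (f x ≡ g x ⊎ g x <₂ f x)

  -- U is <₁,<₂-#-decreasing  (A ∪ {x} is represented by x ∷ A)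
  HashDecreasing : Rel (Pt X k) _ → Rel (Pt X k) _ → FunAssign X k → Set
  HashDecreasing _<₁_ _<₂_ 𝒰 =
    ∀ (A : List (Pt X k)) (x : Pt X k) →
      GraphSub A (U A) (x ∷ A) (U (x ∷ A))
      ⊎ (∃[ y ] (y ∈ A × x <₁ y × U (x ∷ A) y <₂ U A y))
    where open FunAssign 𝒰

  StarDecreasing : Rel (Pt X k) _ → Rel (Pt X k) _ → FunAssign X k → Set
  StarDecreasing _<₁_ _<₂_ 𝒰 =
    ∀ (A B : List (Pt X k)) → Star _<₁_ _<₂_ A (U A) B (U B)
    where open FunAssign 𝒰

  EndSub : Rel (Pt X k) _ → List (Pt X k) → List (Pt X k) → Set
  EndSub _<_ A B =
    (∀ x → x ∈ A → x ∈ B) × (∀ x y → x ∈ A → y ∈ B → y < x → y ∈ A)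

  EndPreserving : Rel (Pt X k) _ → FunAssign X k → Set
  EndPreserving _<_ 𝒰 =
    ∀ (A B : List (Pt X k)) → EndSub _<_ A B → GraphSub A (U A) B (U B)
    where open FunAssign 𝒰

-- If U(A) and U(B) agree on everything <₁-below x, then by end-preservation U(A)(x) and
-- U(B)(x) only depend on the <₁-down-sets of x in A and in B. Pass between these down-sets one
-- point z at a time, always a <₁-maximal point of the larger one missing from the smaller.
-- #-decrease forces the first point y whose value changes to lie above z and to strictly
-- <₂-decrease there. By induction on the size of B, such a change strictly below x would
-- contradict the assumed agreement, so the only change that can happen at x is a <₂-decrease.
module Submission where

open import Defs
open import Level using (0ℓ)
open import Axiom.ExcludedMiddle using (ExcludedMiddle)
open import Data.Nat using (ℕ; _<_)
open import Data.Product using (_×_)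
open import Relation.Binary.PropositionalEquality using (_≡_)
open import Relation.Binary.Core using (Rel)
open import Relation.Binary.Structures using (IsStrictPartialOrder)
open import Function.Bundles using (_⇔_)

open import Data.Nat using (_≤_)
open import Data.Nat.Properties using (<-≤-trans)
open import Data.Nat.Induction using (<-wellFounded)
open import Induction.WellFounded using (Acc; acc)
open import Data.List using (List; []; _∷_; length; filter)
open import Data.List.Properties using (length-filter; filter-notAll)
open import Data.List.Membership.Propositional using (_∈_)
open import Data.List.Membership.Propositional.Properties using (∈-filter⁺; ∈-filter⁻)
open import Data.List.Relation.Binary.Subset.Propositional using (_⊆_)
open import Data.List.Relation.Unary.Any using (here; there)
import Data.List.Relation.Unary.Any as Any
open import Data.Product using (_,_; proj₁; proj₂; ∃-syntax)
open import Data.Sum using (_⊎_; inj₁; inj₂)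
open import Data.Empty using (⊥-elim)
open import Function using (id)
open import Function.Bundles using (mk⇔)
open import Relation.Nullary using (¬_; yes; no)
open import Relation.Binary.PropositionalEquality using (refl; sym; trans; subst; subst₂)
import Relation.Binary.Construct.Flip.EqAndOrd as Flip

module Classical (em : ExcludedMiddle 0ℓ) where

  select : {A : Set} → (A → Set) → List A → List A
  select Q = filter {P = Q} (λ _ → em)

  module _ {A : Set} {_<_ : Rel A 0ℓ} (<-spo : IsStrictPartialOrder _≡_ _<_) where
    open IsStrictPartialOrder <-spo using (irrefl) renaming (trans to <-trans)

    allOrMinimalCounterexample : (Q : A → Set) (L : List A) →
      (∀ y → y ∈ L → Q y) ⊎ ∃[ y ] (y ∈ L × ¬ Q y × (∀ w → w ∈ L → w < y → Q w))
    allOrMinimalCounterexample Q [] = inj₁ (λ _ ())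
    allOrMinimalCounterexample Q (a ∷ L) with allOrMinimalCounterexample Q L | em {Q a}
    ... | inj₁ all | yes qa = inj₁ λ { _ (here refl) → qa ; y (there yL) → all y yL }
    ... | inj₁ all | no ¬qa = inj₂ (a , here refl , ¬qa ,
          λ { _ (here refl) a<a → ⊥-elim (irrefl refl a<a) ; w (there wL) _ → all w wL })
    ... | inj₂ (m , mL , ¬qm , below-m) | yes qa = inj₂ (m , there mL , ¬qm ,
          λ { _ (here refl) _ → qa ; w (there wL) → below-m w wL })
    ... | inj₂ (m , mL , ¬qm , below-m) | no ¬qa with em {a < m}
    ...   | yes a<m = inj₂ (a , here refl , ¬qa ,
            λ { _ (here refl) a<a → ⊥-elim (irrefl refl a<a)
              ; w (there wL) w<a → below-m w wL (<-trans w<a a<m) })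
    ...   | no a≮m = inj₂ (m , there mL , ¬qm ,
            λ { _ (here refl) a<m → ⊥-elim (a≮m a<m) ; w (there wL) → below-m w wL })

module Proof (em : ExcludedMiddle 0ℓ) {X : Set} {k : ℕ}
  (_<₁_ _<₂_ : Rel (Pt X k) 0ℓ)
  (<₁-spo : IsStrictPartialOrder _≡_ _<₁_) (<₂-spo : IsStrictPartialOrder _≡_ _<₂_)
  (𝒰 : FunAssign X k) where

  open Classical em
  open FunAssign 𝒰
  open IsStrictPartialOrder <₁-spo using () renaming (trans to <₁-trans)
  open IsStrictPartialOrder <₂-spo using () renaming (trans to <₂-trans; irrefl to <₂-irrefl)

  P : Set
  P = Pt X k

  _≤₁_ : Rel P 0ℓ
  a ≤₁ b = a ≡ b ⊎ a <₁ b

  -- Oriented so that  U B x ≤₂ U A x  unfolds to the conclusion of Star.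
  _≤₂_ : Rel P 0ℓ
  a ≤₂ b = b ≡ a ⊎ a <₂ b

  <₂-≤₂-trans : ∀ {a b c} → a <₂ b → b ≤₂ c → a <₂ c
  <₂-≤₂-trans a<b (inj₁ refl) = a<b
  <₂-≤₂-trans a<b (inj₂ b<c) = <₂-trans a<b b<c

  ≤₁-<₁-trans : ∀ {a b c} → a <₁ b → b ≤₁ c → a <₁ c
  ≤₁-<₁-trans a<b (inj₁ refl) = a<b
  ≤₁-<₁-trans a<b (inj₂ b<c) = <₁-trans a<b b<c

  Below : P → List P → List P
  Below x = select (_≤₁ x)

  without : P → List P → List P
  without z = select (λ w → ¬ w ≡ z)

  ∈-Below⁺ : ∀ {a x L} → a ∈ L → a ≤₁ x → a ∈ Below x L
  ∈-Below⁺ = ∈-filter⁺ (λ _ → em)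

  ∈-Below⁻ : ∀ {a x L} → a ∈ Below x L → a ∈ L × a ≤₁ x
  ∈-Below⁻ = ∈-filter⁻ (λ _ → em)

  length-Below : ∀ {x} L → length (Below x L) ≤ length L
  length-Below = length-filter (λ _ → em)

  ∈-without⁺ : ∀ {a z L} → a ∈ L → ¬ a ≡ z → a ∈ without z L
  ∈-without⁺ = ∈-filter⁺ (λ _ → em)

  ∈-without⁻ : ∀ {a z L} → a ∈ without z L → a ∈ L
  ∈-without⁻ a∈C = proj₁ (∈-filter⁻ (λ _ → em) a∈C)

  length-without : ∀ {z B} → z ∈ B → length (without z B) < length B
  length-without z∈B = filter-notAll (λ _ → em) _ (Any.map (λ z≡w w≢z → w≢z (sym z≡w)) z∈B)

  ∷-without-⊆ : ∀ {z B} → z ∈ B → z ∷ without z B ⊆ B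
  ∷-without-⊆ z∈B (here refl) = z∈B
  ∷-without-⊆ z∈B (there w∈C) = ∈-without⁻ w∈C

  ⊆-∷-without : ∀ {z} B → B ⊆ z ∷ without z B
  ⊆-∷-without {z} B {w} w∈B with em {w ≡ z}
  ... | yes refl = here refl
  ... | no w≢z = there (∈-without⁺ w∈B w≢z)

  AgreeBelow : List P → List P → P → Set
  AgreeBelow A B x = ∀ w → w ∈ A → w <₁ x → w ∈ B × U A w ≡ U B w

  StarAt : List P → List P → P → Set
  StarAt A B x = x ∈ A → x ∈ B → AgreeBelow A B x → U B x ≤₂ U A x

  GraphSub-trans : ∀ {A B C} {f g h : P → P} →
    GraphSub A f B g → GraphSub B g C h → GraphSub A f C h
  GraphSub-trans A→B B→C y y∈A with A→B y y∈A
  ... | y∈B , gy≡fy with B→C y y∈B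
  ...   | y∈C , hy≡gy = y∈C , trans hy≡gy gy≡fy

  U-ext : ∀ {A B} → A ⊆ B → B ⊆ A → GraphSub A (U A) B (U B)
  U-ext {A} {B} A⊆B B⊆A y y∈A = A⊆B y∈A , sym (ext A B (λ z → mk⇔ A⊆B B⊆A) y y∈A)

  Below-endSub : ∀ {y C L} → C ⊆ L → (∀ {c} → c ∈ L → c <₁ y → c ∈ C) →
    EndSub _<₁_ (Below y C) L
  Below-endSub {y} {C} C⊆L below-y = (λ a a∈D → C⊆L (proj₁ (∈-Below⁻ {x = y} {C} a∈D)))
    , λ a c a∈D c∈L c<a → let c<y = ≤₁-<₁-trans c<a (proj₂ (∈-Below⁻ {x = y} {C} a∈D))
                           in ∈-Below⁺ (below-y c∈L c<y) (inj₂ c<y)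

  ∷-endSub : ∀ {z D L} → EndSub _<₁_ D L → (∀ c → c ∈ L → c <₁ z → c ∈ D) →
    EndSub _<₁_ (z ∷ D) (z ∷ L)
  ∷-endSub (D⊆L , down) below-z =
      (λ { _ (here refl) → here refl ; a (there a∈D) → there (D⊆L a a∈D) })
    , λ { a _ _ (here refl) _ → here refl
        ; _ c (here refl) (there c∈L) c<z → there (below-z c c∈L c<z)
        ; a c (there a∈D) (there c∈L) c<a → there (down a c a∈D c∈L c<a) }

  StarD⇒HashD : StarDecreasing _<₁_ _<₂_ 𝒰 → HashDecreasing _<₁_ _<₂_ 𝒰
  StarD⇒HashD star A x
    with allOrMinimalCounterexample <₁-spo (λ y → U (x ∷ A) y ≡ U A y) A
  ... | inj₁ same = inj₁ (λ y y∈A → there y∈A , same y y∈A)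
  ... | inj₂ (y , y∈A , changed , before) = inj₂ (y , y∈A , x<y , decrease)
    where
      decrease : U (x ∷ A) y <₂ U A y
      decrease with star A (x ∷ A) y y∈A (there y∈A)
                       (λ w w∈A w<y → there w∈A , sym (before w w∈A w<y))
      ... | inj₁ e = ⊥-elim (changed (sym e))
      ... | inj₂ d = d

      agree-if-x≮y : ¬ x <₁ y → AgreeBelow (x ∷ A) A y
      agree-if-x≮y x≮y _ (here refl) x<y = ⊥-elim (x≮y x<y)
      agree-if-x≮y x≮y w (there w∈A) w<y = w∈A , before w w∈A w<y

      x<y : x <₁ y
      x<y with em {x <₁ y}
      ... | yes x<y = x<y
      ... | no x≮y with star (x ∷ A) A y (there y∈A) y∈A (agree-if-x≮y x≮y)
      ...   | inj₁ e = ⊥-elim (changed e)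
      ...   | inj₂ d = ⊥-elim (<₂-irrefl refl (<₂-trans d decrease))

  module FromHash (hash : HashDecreasing _<₁_ _<₂_ 𝒰) where

    endPreserving-acc : ∀ B → Acc _<_ (length B) → ∀ A → EndSub _<₁_ A B →
      GraphSub A (U A) B (U B)
    endPreserving-acc B (acc rs) A (A⊆B , down)
      with allOrMinimalCounterexample (Flip.isStrictPartialOrder <₁-spo) (_∈ A) B
    ... | inj₁ B⊆A = U-ext (λ {y} → A⊆B y) (λ {y} → B⊆A y)
    ... | inj₂ (z , z∈B , z∉A , above-z) with hash (without z B) z
    ...   | inj₁ C→zC =
      GraphSub-trans A→C (GraphSub-trans C→zC (U-ext (∷-without-⊆ z∈B) (⊆-∷-without B)))
      where
        A→C : GraphSub A (U A) (without z B) (U (without z B))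
        A→C = endPreserving-acc _ (rs (length-without z∈B)) A
          ( (λ a a∈A → ∈-without⁺ (A⊆B a a∈A) (λ { refl → z∉A a∈A }))
          , (λ a c a∈A c∈C c<a → down a c a∈A (∈-without⁻ c∈C) c<a) )
    ...   | inj₂ (y , y∈C , z<y , _) = ⊥-elim (z∉A (down y z y∈A z∈B z<y))
      where
        y∈A : y ∈ A
        y∈A = above-z y (∈-without⁻ y∈C) z<y

    endPreserving : ∀ {A B} → EndSub _<₁_ A B → GraphSub A (U A) B (U B)
    endPreserving {A} {B} = endPreserving-acc B (<-wellFounded (length B)) A

    Below-agrees : ∀ {y} L → GraphSub (Below y L) (U (Below y L)) L (U L)
    Below-agrees L = endPreserving (Below-endSub id (λ c∈L _ → c∈L))

    firstChangeDecreases : ∀ C z →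
      GraphSub C (U C) (z ∷ C) (U (z ∷ C))
      ⊎ ∃[ y ] (y ∈ C × z <₁ y × U (z ∷ C) y <₂ U C y
                × (∀ w → w ∈ C → w <₁ y → U (z ∷ C) w ≡ U C w))
    firstChangeDecreases C z
      with allOrMinimalCounterexample <₁-spo (λ y → U (z ∷ C) y ≡ U C y) C
    ... | inj₁ same = inj₁ (λ y y∈C → there y∈C , same y y∈C)
    ... | inj₂ (y , y∈C , changed , before) with em {z <₁ y}
    ...   | no z≮y =
      ⊥-elim (changed (trans (proj₂ (D→zC y y∈D)) (sym (proj₂ (Below-agrees C y y∈D)))))
      where
        y∈D : y ∈ Below y C
        y∈D = ∈-Below⁺ y∈C (inj₁ refl)
        D→zC : GraphSub (Below y C) (U (Below y C)) (z ∷ C) (U (z ∷ C))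
        D→zC = endPreserving (Below-endSub there
                 λ { (here refl) z<y → ⊥-elim (z≮y z<y) ; (there c∈C) _ → c∈C })
    ...   | yes z<y = inj₂ (y , y∈C , z<y , decrease (hash D z) , before)
      where
        D : List P
        D = Below y C
        y∈D : y ∈ D
        y∈D = ∈-Below⁺ y∈C (inj₁ refl)
        D→C : GraphSub D (U D) C (U C)
        D→C = Below-agrees C
        zD→zC : GraphSub (z ∷ D) (U (z ∷ D)) (z ∷ C) (U (z ∷ C))
        zD→zC = endPreserving (∷-endSub (Below-endSub id (λ c∈C _ → c∈C))
                  λ c c∈C c<z → ∈-Below⁺ c∈C (inj₂ (<₁-trans c<z z<y)))
        transfer : ∀ {v} → v ∈ D → U (z ∷ C) v ≡ U (z ∷ D) v × U C v ≡ U D v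
        transfer v∈D = proj₂ (zD→zC _ (there v∈D)) , proj₂ (D→C _ v∈D)
        decrease : GraphSub D (U D) (z ∷ D) (U (z ∷ D))
                   ⊎ ∃[ v ] (v ∈ D × z <₁ v × U (z ∷ D) v <₂ U D v) →
                   U (z ∷ C) y <₂ U C y
        decrease (inj₁ D→zD) with transfer y∈D
        ... | zC≡zD , C≡D =
          ⊥-elim (changed (trans zC≡zD (trans (proj₂ (D→zD y y∈D)) (sym C≡D))))
        decrease (inj₂ (v , v∈D , _ , dec)) with transfer v∈D | proj₂ (∈-Below⁻ {x = y} {C} v∈D)
        ... | zC≡zD , C≡D | inj₁ refl = subst₂ _<₂_ (sym zC≡zD) (sym C≡D) dec
        ... | zC≡zD , C≡D | inj₂ v<y =
          ⊥-elim (<₂-irrefl (trans (sym zC≡zD) (trans (before v v∈C v<y) C≡D)) dec)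
          where
            v∈C : v ∈ C
            v∈C = proj₁ (∈-Below⁻ {x = y} v∈D)

    StarBelow : ℕ → Set
    StarBelow n = ∀ C → length C < n → ∀ A x → StarAt A C x

    starAt-topped : ∀ {A B x} → StarBelow (length B) → A ⊆ B → x ∈ A →
      (∀ {a} → a ∈ A → a ≤₁ x) → (∀ w → w ∈ A → w <₁ x → U A w ≡ U B w) → U B x ≤₂ U A x
    starAt-topped {A} {B} {x} ih A⊆B x∈A below-x agree
      with allOrMinimalCounterexample (Flip.isStrictPartialOrder <₁-spo) (_∈ A) B
    ... | inj₁ B⊆A = inj₁ (sym (proj₂ (U-ext A⊆B (λ {y} → B⊆A y) x x∈A)))
    ... | inj₂ (z , z∈B , z∉A , above-z) = settle (firstChangeDecreases C z)
      where
        C : List P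
        C = without z B
        |C|<|B| : length C < length B
        |C|<|B| = length-without z∈B
        A⊆C : A ⊆ C
        A⊆C a∈A = ∈-without⁺ (A⊆B a∈A) (λ { refl → z∉A a∈A })
        zC→B : ∀ v → v ∈ z ∷ C → U B v ≡ U (z ∷ C) v
        zC→B v v∈zC = proj₂ (U-ext (∷-without-⊆ z∈B) (⊆-∷-without B) v v∈zC)
        settle : GraphSub C (U C) (z ∷ C) (U (z ∷ C))
                 ⊎ ∃[ y ] (y ∈ C × z <₁ y × U (z ∷ C) y <₂ U C y
                           × (∀ w → w ∈ C → w <₁ y → U (z ∷ C) w ≡ U C w)) →
                 U B x ≤₂ U A x
        settle (inj₁ C→zC) =
          subst (_≤₂ U A x) (C≡B (A⊆C x∈A)) (ih C |C|<|B| A x x∈A (A⊆C x∈A) agree-C)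
          where
            C≡B : ∀ {v} → v ∈ C → U C v ≡ U B v
            C≡B v∈C = trans (sym (proj₂ (C→zC _ v∈C))) (sym (zC→B _ (there v∈C)))
            agree-C : AgreeBelow A C x
            agree-C w w∈A w<x = A⊆C w∈A , trans (agree w w∈A w<x) (sym (C≡B (A⊆C w∈A)))
        settle (inj₂ (y , y∈C , z<y , dec , before)) = atTopOrBelow (below-x y∈A)
          where
            y∈A : y ∈ A
            y∈A = above-z y (∈-without⁻ y∈C) z<y
            B≡C : ∀ {w} → w ∈ C → w <₁ y → U B w ≡ U C w
            B≡C w∈C w<y = trans (zC→B _ (there w∈C)) (before _ w∈C w<y)
            agree-C : AgreeBelow A C y
            agree-C w w∈A w<y = A⊆C w∈A
              , trans (agree w w∈A (≤₁-<₁-trans w<y (below-x y∈A))) (B≡C (A⊆C w∈A) w<y)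
            B<A : U B y <₂ U A y
            B<A = <₂-≤₂-trans (subst (_<₂ U C y) (sym (zC→B y (there y∈C))) dec)
                              (ih C |C|<|B| A y y∈A (A⊆C y∈A) agree-C)
            atTopOrBelow : y ≤₁ x → U B x ≤₂ U A x
            atTopOrBelow (inj₁ refl) = inj₂ B<A
            atTopOrBelow (inj₂ y<x) = ⊥-elim (<₂-irrefl (sym (agree y y∈A y<x)) B<A)

    starAt : ∀ B → Acc _<_ (length B) → ∀ A x → StarAt A B x
    starAt B (acc rs) A x x∈A x∈B agree =
      subst₂ _≤₂_ (sym (proj₂ (Below-agrees B x x∈B′))) (sym (proj₂ (Below-agrees A x x∈A′)))
        (starAt-topped ih A′⊆B′ x∈A′ (λ a∈A′ → proj₂ (∈-Below⁻ {x = x} {A} a∈A′)) agree′)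
      where
        A′ B′ : List P
        A′ = Below x A
        B′ = Below x B
        x∈A′ : x ∈ A′
        x∈A′ = ∈-Below⁺ x∈A (inj₁ refl)
        x∈B′ : x ∈ B′
        x∈B′ = ∈-Below⁺ x∈B (inj₁ refl)
        ih : StarBelow (length B′)
        ih C |C|<|B′| = starAt C (rs (<-≤-trans |C|<|B′| (length-Below B)))
        A′⊆B′ : A′ ⊆ B′
        A′⊆B′ a∈A′ with ∈-Below⁻ {x = x} a∈A′
        ... | _ , inj₁ refl = x∈B′
        ... | a∈A , inj₂ a<x = ∈-Below⁺ (proj₁ (agree _ a∈A a<x)) (inj₂ a<x)
        agree′ : ∀ w → w ∈ A′ → w <₁ x → U A′ w ≡ U B′ w
        agree′ w w∈A′ w<x with ∈-Below⁻ {x = x} w∈A′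
        ... | w∈A , _ = trans (sym (proj₂ (Below-agrees A w w∈A′)))
                          (trans (proj₂ (agree w w∈A w<x))
                                 (proj₂ (Below-agrees B w (A′⊆B′ w∈A′))))

    HashD⇒StarD : StarDecreasing _<₁_ _<₂_ 𝒰
    HashD⇒StarD A B = starAt B (<-wellFounded (length B)) A

    HashD⇒EndPreserving : EndPreserving _<₁_ 𝒰
    HashD⇒EndPreserving A B = endPreserving

theorem3p10 : ExcludedMiddle 0ℓ →
    (k : ℕ) → 0 < k → (X : Set) →
    (_<₁_ _<₂_ : Rel (Pt X k) 0ℓ) →
    IsStrictPartialOrder _≡_ _<₁_ → IsStrictPartialOrder _≡_ _<₂_ →
    (𝒰 : FunAssign X k) →
    (HashDecreasing _<₁_ _<₂_ 𝒰 ⇔ StarDecreasing _<₁_ _<₂_ 𝒰)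
    × (HashDecreasing _<₁_ _<₂_ 𝒰 → EndPreserving _<₁_ 𝒰)
theorem3p10 em _ _ _ _<₁_ _<₂_ <₁-spo <₂-spo 𝒰 =
  mk⇔ HashD⇒StarD StarD⇒HashD , HashD⇒EndPreserving
  where
    open Proof em _<₁_ _<₂_ <₁-spo <₂-spo 𝒰
    open FromHash using (HashD⇒StarD; HashD⇒EndPreserving)
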